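{- Let $\sigma\le\pi$ be permutations, and let $F\colon[\sigma,\pi]\to\mathbb{R}$ be a function satisfying $F(\pi)=1$. Then \[\mu[\sigma,\pi]=F(\sigma)-\sum_{\lambda\in[\sigma,\pi)}\mu[\sigma,\lambda]\sum_{\tau\in[\lambda,\pi]}F(\tau).\]
   Context: Permutations (including the empty permutation) are ordered by containment: $\sigma\le\pi$ if $\pi$ has a subsequence order-isomorphic to $\sigma$. $[\sigma,\pi]=\{\tau:\sigma\le\tau\le\pi\}$, $[\sigma,\pi)=\{\tau:\sigma\le\tau<\pi\}$. The Möbius function: $\mu[\sigma,\pi]=0$ if $\sigma\not\le\pi$, $\mu[\sigma,\pi]=1$ if $\sigma=\pi$, and $\mu[\sigma,\pi]=-\sum_{\tau\in[\sigma,\pi)}\mu[\sigma,\tau]$ otherwise. -}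

module Defs where

open import Level using (Level)
open import Data.Bool using (Bool; true; false; _∧_; not; if_then_else_; T)
open import Data.Nat using (ℕ; zero; suc; _<ᵇ_; _≡ᵇ_)
open import Data.List using (List; []; _∷_; map; _++_; concatMap; length; upTo; filterᵇ; zip; foldr)
open import Data.Bool.ListAction using (all; any)
open import Data.Product using (_,_; proj₁; proj₂)
open import Data.List.Relation.Binary.Permutation.Propositional using (_↭_)
open import Algebra.Bundles using (CommutativeRing)

-- Permutations of length n are lists of naturals that are rearrangements of 0,...,n-1
-- (one-line notation, values 0-based). The empty list is the empty permutation.
Perm : Set
Perm = List ℕ

IsPerm : Perm → Set
IsPerm l = l ↭ upTo (length l)

_==L_ : List ℕ → List ℕ → Bool
[] ==L [] = true
[] ==L (_ ∷ _) = false
(_ ∷ _) ==L [] = false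
(x ∷ xs) ==L (y ∷ ys) = (x ≡ᵇ y) ∧ (xs ==L ys)

_==B_ : Bool → Bool → Bool
true ==B b = b
false ==B b = not b

subsequences : List ℕ → List (List ℕ)
subsequences [] = [] ∷ []
subsequences (x ∷ xs) = map (x ∷_) (subsequences xs) ++ subsequences xs

sameLength : List ℕ → List ℕ → Bool
sameLength [] [] = true
sameLength [] (_ ∷ _) = false
sameLength (_ ∷ _) [] = false
sameLength (_ ∷ xs) (_ ∷ ys) = sameLength xs ys

orderIso : List ℕ → List ℕ → Bool
orderIso a b = sameLength a b ∧
  all (λ p → all (λ q → (proj₁ p <ᵇ proj₁ q) ==B (proj₂ p <ᵇ proj₂ q)) (zip a b)) (zip a b)

contains : Perm → Perm → Bool
contains σ π = any (orderIso σ) (subsequences π)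

_≤P_ : Perm → Perm → Set
σ ≤P π = T (contains σ π)

insertions : ℕ → List ℕ → List (List ℕ)
insertions x [] = (x ∷ []) ∷ []
insertions x (y ∷ ys) = (x ∷ y ∷ ys) ∷ map (y ∷_) (insertions x ys)

perms : ℕ → List Perm
perms zero = [] ∷ []
perms (suc k) = concatMap (insertions k) (perms k)

permsUpTo : ℕ → List Perm
permsUpTo n = concatMap perms (upTo (suc n))

-- the intervals [σ,π] and [σ,π), as lists (each element exactly once)
closedInterval : Perm → Perm → List Perm
closedInterval σ π = filterᵇ (λ τ → contains σ τ ∧ contains τ π) (permsUpTo (length π))

halfOpenInterval : Perm → Perm → List Perm
halfOpenInterval σ π = filterᵇ (λ τ → not (τ ==L π)) (closedInterval σ π)

module _ {c ℓ : Level} (R : CommutativeRing c ℓ) where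
  open CommutativeRing R

  Σ : {A : Set} → List A → (A → Carrier) → Carrier
  Σ xs f = foldr (λ x acc → f x + acc) 0# xs

  -- Möbius function, by the defining recursion; the fuel bounds the length of π
  -- (every τ ∈ [σ,π) is shorter than π, so fuel = length π suffices).
  μ-fuel : ℕ → Perm → Perm → Carrier
  μ-fuel n σ π with contains σ π | σ ==L π
  ... | false | _ = 0#
  ... | true | true = 1#
  μ-fuel zero σ π | true | false = 0#
  μ-fuel (suc n) σ π | true | false = - Σ (halfOpenInterval σ π) (λ τ → μ-fuel n σ τ)

  μ : Perm → Perm → Carrier
  μ σ π = μ-fuel (length π) σ π

module Submission where

-- Idea.  The double sum runs over the pairs σ ≤ λ ≤ τ ≤ π with λ ≠ π; summing over λ
-- first it becomes Σ_{τ ∈ [σ,π]} F(τ) Σ_{λ ∈ [σ,τ], λ ≠ π} μ[σ,λ].  By the defining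
-- recursion Σ_{λ ∈ [σ,τ]} μ[σ,λ] = δ(σ,τ), and leaving out λ = π only matters for
-- τ = π, where it removes the term μ[σ,π].  So for every F the double sum equals
-- F(σ) - F(π) μ[σ,π], and F(π) = 1 gives the proposition.

open import Defs
open import Algebra.Bundles using (CommutativeRing)
open import Data.Bool.ListAction using (all)
open import Data.Bool using (Bool; true; false; _∧_; not; if_then_else_; T; T?)
open import Data.Bool.Properties using (T-≡; T-∧)
open import Data.Nat using (ℕ; zero; suc; _<ᵇ_; _≡ᵇ_; _≤_; _<_; _∸_; _⊓_; z≤n; s≤s) renaming (_+_ to _+ℕ_)
import Data.Nat.Properties as ℕ
open import Data.Nat.Properties using (_≟_; _≤?_; ≡ᵇ⇒≡; ≡⇒≡ᵇ; <ᵇ⇒<; <⇒<ᵇ; ⊓-zeroʳ; m≥n⇒m⊓n≡n; m≤n⇒m⊓n≡m; <⇒≤; ≮⇒≥; m≤n⇒m≤1+n; ≤-antisym; n<1+n; <-irrefl; ≤-trans; ≤-refl; ≤-reflexive; ≤-pred; suc-injective; 1+n≢0; ≰⇒>; m∸n+n≡m; <⇒≱; m≤n+m; ≤∧≢⇒<)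
open import Data.List using (List; []; _∷_; map; _++_; concatMap; length; upTo; zip; filterᵇ; [_])
open import Data.List.Properties using (upTo-∷ʳ; length-map; map-∘; map-id; map-cong; map-cong-local; ∷-injective; concatMap-++; length-upTo; ++-identityʳ; filter-++; filter-none)
open import Data.List.Membership.Propositional using (_∈_; find; lose)
open import Data.List.Membership.Propositional.Properties using (∈-map⁺; ∈-map⁻; ∈-++⁺ˡ; ∈-++⁺ʳ; ∈-++⁻; ∈-upTo⁻; ∈-upTo⁺; ∈-concat⁻′; ∈-filter⁻)
open import Data.List.Relation.Unary.Any using (here; there)
import Data.List.Relation.Unary.All as All
open import Data.List.Relation.Unary.Any.Properties using (any⁺; any⁻)
open import Data.List.Relation.Unary.All.Properties using (all⁺; all⁻)
open import Data.List.Relation.Binary.Sublist.Propositional using (_⊆_; []; _∷_; _∷ʳ_; ⊆-reflexive; ⊆-trans; lookup)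
open import Data.List.Relation.Binary.Sublist.Propositional.Properties using (length-mono-≤; to-≋; map⁺)
open import Data.List.Relation.Binary.Equality.Propositional using (≋⇒≡)
import Data.List.Relation.Binary.Permutation.Propositional as ↭
open import Data.List.Relation.Binary.Permutation.Propositional using (_↭_; ↭-sym; ↭-trans)
open import Data.List.Relation.Binary.Permutation.Propositional.Properties using (∈-resp-↭; ↭-length; drop-∷; ∷↭∷ʳ; shift; ↭-empty-inv)
open import Data.Product using (∃; _×_; _,_; proj₁; proj₂)
open import Data.Sum using (inj₁; inj₂)
open import Data.Empty using (⊥; ⊥-elim)
open import Function using (Equivalence; _∘_)
open import Relation.Nullary using (¬_; Dec; yes; no; contradiction)
open import Relation.Binary.PropositionalEquality using (_≡_; _≢_; refl; sym; trans; cong; cong₂; subst; ≢-sym; module ≡-Reasoning)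

T⇒≡true : ∀ {b} → T b → b ≡ true
T⇒≡true = Equivalence.to T-≡

T⇐≡true : ∀ {b} → b ≡ true → T b
T⇐≡true = Equivalence.from T-≡

==L⇒≡ : ∀ xs ys → T (xs ==L ys) → xs ≡ ys
==L⇒≡ [] [] _ = refl
==L⇒≡ (x ∷ xs) (y ∷ ys) h with x ≡ᵇ y in e
... | true = cong₂ _∷_ (≡ᵇ⇒≡ x y (T⇐≡true e)) (==L⇒≡ xs ys h)

==L-refl : ∀ xs → (xs ==L xs) ≡ true
==L-refl [] = refl
==L-refl (x ∷ xs) rewrite T⇒≡true (≡⇒≡ᵇ x x refl) = ==L-refl xs

==L-false⇒≢ : ∀ xs ys → (xs ==L ys) ≡ false → xs ≢ ys
==L-false⇒≢ xs .xs xs≠xs refl = contradiction (trans (sym (==L-refl xs)) xs≠xs) λ ()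

≢⇒==L-false : ∀ xs ys → xs ≢ ys → (xs ==L ys) ≡ false
≢⇒==L-false xs ys xs≢ys with xs ==L ys in e
... | true = ⊥-elim (xs≢ys (==L⇒≡ xs ys (T⇐≡true e)))
... | false = refl

==B⇒≡ : ∀ a b → T (a ==B b) → a ≡ b
==B⇒≡ true true _ = refl
==B⇒≡ false false _ = refl

==B-refl : ∀ a → T (a ==B a)
==B-refl true = _
==B-refl false = _

count : {A : Set} → (A → Bool) → List A → ℕ
count p [] = 0
count p (x ∷ xs) = if p x then suc (count p xs) else count p xs

count-++ : {A : Set} (p : A → Bool) (xs ys : List A) → count p (xs ++ ys) ≡ count p xs +ℕ count p ys
count-++ p [] ys = refl
count-++ p (x ∷ xs) ys with p x
... | true = cong suc (count-++ p xs ys)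
... | false = count-++ p xs ys

count-map : {A B : Set} (p : B → Bool) (f : A → B) (xs : List A) →
  count p (map f xs) ≡ count (λ x → p (f x)) xs
count-map p f [] = refl
count-map p f (x ∷ xs) with p (f x)
... | true = cong suc (count-map p f xs)
... | false = count-map p f xs

count-cong : {A : Set} (p q : A → Bool) (xs : List A) →
  (∀ {x} → x ∈ xs → p x ≡ q x) → count p xs ≡ count q xs
count-cong p q [] _ = refl
count-cong p q (x ∷ xs) p≗q with p x | q x | p≗q (here refl)
... | true | true | _ = cong suc (count-cong p q xs (λ m → p≗q (there m)))
... | false | false | _ = count-cong p q xs (λ m → p≗q (there m))

count-↭ : {A : Set} (p : A → Bool) {xs ys : List A} → xs ↭ ys → count p xs ≡ count p ys
count-↭ p ↭.refl = refl
count-↭ p (↭.prep x r) with p x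
... | true = cong suc (count-↭ p r)
... | false = count-↭ p r
count-↭ p (↭.swap x y r) with p x | p y
... | true | true = cong (λ k → suc (suc k)) (count-↭ p r)
... | true | false = cong suc (count-↭ p r)
... | false | true = cong suc (count-↭ p r)
... | false | false = count-↭ p r
count-↭ p (↭.trans r s) = trans (count-↭ p r) (count-↭ p s)

count-absent : {A : Set} (p : A → Bool) (xs : List A) → (∀ {x} → x ∈ xs → p x ≡ false) → count p xs ≡ 0
count-absent p [] _ = refl
count-absent p (x ∷ xs) h rewrite h (here refl) = count-absent p xs (λ x∈ → h (there x∈))

count≡0⇒rejects : {A : Set} (p : A → Bool) (xs : List A) → count p xs ≡ 0 → ∀ {x} → x ∈ xs → p x ≡ false
count≡0⇒rejects p (y ∷ xs) none x∈ with p y in py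
... | true = ⊥-elim (1+n≢0 none)
... | false with x∈
...   | here refl = py
...   | there x∈′ = count≡0⇒rejects p xs none x∈′

count-below-upTo : ∀ n x → count (_<ᵇ x) (upTo n) ≡ x ⊓ n
count-below-upTo zero x = sym (⊓-zeroʳ x)
count-below-upTo (suc n) x = begin
    count (_<ᵇ x) (upTo (suc n))
  ≡⟨ cong (count (_<ᵇ x)) (sym (upTo-∷ʳ n)) ⟩
    count (_<ᵇ x) (upTo n ++ [ n ])
  ≡⟨ count-++ (_<ᵇ x) (upTo n) [ n ] ⟩
    count (_<ᵇ x) (upTo n) +ℕ count (_<ᵇ x) [ n ]
  ≡⟨ cong (_+ℕ count (_<ᵇ x) [ n ]) (count-below-upTo n x) ⟩
    x ⊓ n +ℕ count (_<ᵇ x) [ n ]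
  ≡⟨ last-step ⟩
    x ⊓ suc n ∎
  where
  open ≡-Reasoning
  last-step : x ⊓ n +ℕ count (_<ᵇ x) [ n ] ≡ x ⊓ suc n
  last-step with n <ᵇ x in e
  ... | true = let n<x = <ᵇ⇒< n x (T⇐≡true e) in begin
      x ⊓ n +ℕ 1   ≡⟨ cong (_+ℕ 1) (m≥n⇒m⊓n≡n (<⇒≤ n<x)) ⟩
      n +ℕ 1       ≡⟨ ℕ.+-comm n 1 ⟩
      suc n        ≡⟨ sym (m≥n⇒m⊓n≡n n<x) ⟩
      x ⊓ suc n    ∎
  ... | false = let x≤n = ≮⇒≥ (λ n<x → subst T e (<⇒<ᵇ n<x)) in begin
      x ⊓ n +ℕ 0   ≡⟨ ℕ.+-identityʳ _ ⟩
      x ⊓ n        ≡⟨ m≤n⇒m⊓n≡m x≤n ⟩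
      x            ≡⟨ sym (m≤n⇒m⊓n≡m (m≤n⇒m≤1+n x≤n)) ⟩
      x ⊓ suc n    ∎

rank-in-perm : ∀ (a : Perm) → IsPerm a → ∀ {x} → x ∈ a → count (_<ᵇ x) a ≡ x
rank-in-perm a a-perm {x} x∈a = begin
    count (_<ᵇ x) a                 ≡⟨ count-↭ (_<ᵇ x) a-perm ⟩
    count (_<ᵇ x) (upTo (length a)) ≡⟨ count-below-upTo (length a) x ⟩
    x ⊓ length a                    ≡⟨ m≤n⇒m⊓n≡m (<⇒≤ (∈-upTo⁻ (∈-resp-↭ a-perm x∈a))) ⟩
    x                               ∎
  where open ≡-Reasoning

⊆⇒∈subsequences : ∀ {s} l → s ⊆ l → s ∈ subsequences l
⊆⇒∈subsequences [] [] = here refl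
⊆⇒∈subsequences (x ∷ l) (.x ∷ʳ s⊆l) = ∈-++⁺ʳ _ (⊆⇒∈subsequences l s⊆l)
⊆⇒∈subsequences (x ∷ l) (refl ∷ s⊆l) = ∈-++⁺ˡ (∈-map⁺ (x ∷_) (⊆⇒∈subsequences l s⊆l))

∈subsequences⇒⊆ : ∀ {s} l → s ∈ subsequences l → s ⊆ l
∈subsequences⇒⊆ [] (here refl) = []
∈subsequences⇒⊆ (x ∷ l) s∈ with ∈-++⁻ (map (x ∷_) (subsequences l)) s∈
... | inj₂ s∈′ = x ∷ʳ ∈subsequences⇒⊆ l s∈′
... | inj₁ s∈′ with ∈-map⁻ (x ∷_) s∈′
...   | s′ , s′∈ , refl = refl ∷ ∈subsequences⇒⊆ l s′∈

⊆-map⁻ : {A B : Set} (f : A → B) {xs : List B} (ys : List A) → xs ⊆ map f ys →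
  ∃ λ ys′ → ys′ ⊆ ys × map f ys′ ≡ xs
⊆-map⁻ f [] [] = [] , [] , refl
⊆-map⁻ f (y ∷ ys) (_ ∷ʳ xs⊆) with ⊆-map⁻ f ys xs⊆
... | ys′ , ys′⊆ys , refl = ys′ , y ∷ʳ ys′⊆ys , refl
⊆-map⁻ f (y ∷ ys) (refl ∷ xs⊆) with ⊆-map⁻ f ys xs⊆
... | ys′ , ys′⊆ys , refl = y ∷ ys′ , refl ∷ ys′⊆ys , refl

Pair : Set
Pair = ℕ × ℕ

SameOrder : List Pair → Set
SameOrder ps = ∀ {p q} → p ∈ ps → q ∈ ps → (proj₁ p <ᵇ proj₁ q) ≡ (proj₂ p <ᵇ proj₂ q)

Occurrence : Perm → Perm → Set
Occurrence a b = ∃ λ ps → map proj₁ ps ≡ a × map proj₂ ps ⊆ b × SameOrder ps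

orderIso⇒SameOrder : ∀ a b → T (orderIso a b) →
  ∃ λ ps → map proj₁ ps ≡ a × map proj₂ ps ≡ b × SameOrder ps
orderIso⇒SameOrder a b iso = zip a b , map₁-zip a b same-length , map₂-zip a b same-length , same-order
  where
  same-length : T (sameLength a b)
  same-length = proj₁ (Equivalence.to T-∧ iso)
  pairwise : ∀ {p} → p ∈ zip a b → T (all (λ q → (proj₁ p <ᵇ proj₁ q) ==B (proj₂ p <ᵇ proj₂ q)) (zip a b))
  pairwise = All.lookup (all⁺ _ (zip a b) (proj₂ (Equivalence.to T-∧ iso)))
  same-order : SameOrder (zip a b)
  same-order p∈ q∈ = ==B⇒≡ _ _ (All.lookup (all⁺ _ (zip a b) (pairwise p∈)) q∈)
  map₁-zip : ∀ a b → T (sameLength a b) → map proj₁ (zip a b) ≡ a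
  map₁-zip [] [] _ = refl
  map₁-zip (x ∷ a) (y ∷ b) h = cong (x ∷_) (map₁-zip a b h)
  map₂-zip : ∀ a b → T (sameLength a b) → map proj₂ (zip a b) ≡ b
  map₂-zip [] [] _ = refl
  map₂-zip (x ∷ a) (y ∷ b) h = cong (y ∷_) (map₂-zip a b h)

zip-map-proj : (ps : List Pair) → zip (map proj₁ ps) (map proj₂ ps) ≡ ps
zip-map-proj [] = refl
zip-map-proj (p ∷ ps) = cong (p ∷_) (zip-map-proj ps)

SameOrder⇒orderIso : ∀ ps → SameOrder ps → T (orderIso (map proj₁ ps) (map proj₂ ps))
SameOrder⇒orderIso ps same rewrite zip-map-proj ps =
  Equivalence.from T-∧ (same-length ps , all⁻ _ (All.tabulate λ {p} p∈ → all⁻ _ (All.tabulate λ {q} q∈ →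
    subst (λ b → T ((proj₁ p <ᵇ proj₁ q) ==B b)) (same p∈ q∈) (==B-refl (proj₁ p <ᵇ proj₁ q)))))
  where
  same-length : (ps : List Pair) → T (sameLength (map proj₁ ps) (map proj₂ ps))
  same-length [] = _
  same-length (p ∷ ps) = same-length ps

≤P⇒Occurrence : ∀ a b → a ≤P b → Occurrence a b
≤P⇒Occurrence a b a≤b with find (any⁻ (orderIso a) (subsequences b) a≤b)
... | s , s∈ , iso with orderIso⇒SameOrder a s iso
...   | ps , e₁ , refl , same = ps , e₁ , ∈subsequences⇒⊆ b s∈ , same

Occurrence⇒≤P : ∀ a b → Occurrence a b → a ≤P b
Occurrence⇒≤P a b (ps , refl , ps⊆b , same) =
  any⁺ (orderIso a) (lose (⊆⇒∈subsequences b ps⊆b) (SameOrder⇒orderIso ps same))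

Occurrence-refl : ∀ a → Occurrence a a
Occurrence-refl a = map diagonal a , undo-diagonal (λ _ → refl) , ⊆-reflexive (undo-diagonal (λ _ → refl)) , same-order
  where
  diagonal : ℕ → Pair
  diagonal x = x , x
  undo-diagonal : ∀ {f : Pair → ℕ} → (∀ x → f (diagonal x) ≡ x) → map f (map diagonal a) ≡ a
  undo-diagonal f∘diagonal≗id = trans (sym (map-∘ a)) (trans (map-cong f∘diagonal≗id a) (map-id a))
  same-order : SameOrder (map diagonal a)
  same-order p∈ q∈ with ∈-map⁻ diagonal p∈ | ∈-map⁻ diagonal q∈
  ... | _ , _ , refl | _ , _ , refl = refl

compose : List Pair → List Pair → List Pair
compose (p ∷ ps) (q ∷ qs) = (proj₁ p , proj₂ q) ∷ compose ps qs
compose _ _ = []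

compose-proj₁ : ∀ ps qs → map proj₂ ps ≡ map proj₁ qs → map proj₁ (compose ps qs) ≡ map proj₁ ps
compose-proj₁ [] [] _ = refl
compose-proj₁ (p ∷ ps) (q ∷ qs) e = cong (proj₁ p ∷_) (compose-proj₁ ps qs (proj₂ (∷-injective e)))

compose-proj₂ : ∀ ps qs → map proj₂ ps ≡ map proj₁ qs → map proj₂ (compose ps qs) ≡ map proj₂ qs
compose-proj₂ [] [] _ = refl
compose-proj₂ (p ∷ ps) (q ∷ qs) e = cong (proj₂ q ∷_) (compose-proj₂ ps qs (proj₂ (∷-injective e)))

compose-∈ : ∀ ps qs → map proj₂ ps ≡ map proj₁ qs → ∀ {r} → r ∈ compose ps qs →
  ∃ λ p → ∃ λ q → p ∈ ps × q ∈ qs × proj₂ p ≡ proj₁ q × r ≡ (proj₁ p , proj₂ q)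
compose-∈ (p ∷ ps) (q ∷ qs) e (here refl) = p , q , here refl , here refl , proj₁ (∷-injective e) , refl
compose-∈ (p ∷ ps) (q ∷ qs) e (there r∈) with compose-∈ ps qs (proj₂ (∷-injective e)) r∈
... | p′ , q′ , p′∈ , q′∈ , e′ , r≡ = p′ , q′ , there p′∈ , there q′∈ , e′ , r≡

-- To compose occurrences, pick out the part of the second one that matches the
-- subsequence of b used by the first.
Occurrence-trans : ∀ {a b c} → Occurrence a b → Occurrence b c → Occurrence a c
Occurrence-trans {c = c} (ps , refl , ps⊆ , same₁) (qs , refl , qs⊆ , same₂) with ⊆-map⁻ proj₁ qs ps⊆
... | qs′ , qs′⊆qs , matched =
  compose ps qs′ ,
  compose-proj₁ ps qs′ (sym matched) ,
  subst (_⊆ c) (sym (compose-proj₂ ps qs′ (sym matched))) (⊆-trans (map⁺ proj₂ qs′⊆qs) qs⊆) ,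
  same
  where
  same : SameOrder (compose ps qs′)
  same r∈ r′∈ with compose-∈ ps qs′ (sym matched) r∈ | compose-∈ ps qs′ (sym matched) r′∈
  ... | p , q , p∈ , q∈ , e , refl | p′ , q′ , p′∈ , q′∈ , e′ , refl =
    trans (same₁ p∈ p′∈) (trans (cong₂ _<ᵇ_ e e′) (same₂ (lookup qs′⊆qs q∈) (lookup qs′⊆qs q′∈)))

Occurrence-length : ∀ {a b} → Occurrence a b → length a ≤ length b
Occurrence-length {b = b} (ps , refl , ps⊆b , _) =
  subst (_≤ length b) (trans (length-map proj₂ ps) (sym (length-map proj₁ ps))) (length-mono-≤ ps⊆b)

-- The ranks of matched entries agree, so a full-length occurrence is the identity.
Occurrence-equal : ∀ {a b} → Occurrence a b → IsPerm a → IsPerm b → length a ≡ length b → a ≡ b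
Occurrence-equal {b = b} (ps , refl , ps⊆b , same) a-perm b-perm equal-length =
  trans (map-cong-local (All.tabulate diagonal)) spells-b
  where
  spells-b : map proj₂ ps ≡ b
  spells-b = ≋⇒≡ (to-≋ (trans (length-map proj₂ ps) (trans (sym (length-map proj₁ ps)) equal-length)) ps⊆b)
  diagonal : ∀ {p} → p ∈ ps → proj₁ p ≡ proj₂ p
  diagonal {p} p∈ = begin
      proj₁ p                                ≡⟨ sym (rank-in-perm (map proj₁ ps) a-perm (∈-map⁺ proj₁ p∈)) ⟩
      count (_<ᵇ proj₁ p) (map proj₁ ps)     ≡⟨ count-map _ proj₁ ps ⟩
      count (λ q → proj₁ q <ᵇ proj₁ p) ps    ≡⟨ count-cong _ _ ps (λ q∈ → same q∈ p∈) ⟩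
      count (λ q → proj₂ q <ᵇ proj₂ p) ps    ≡⟨ sym (count-map _ proj₂ ps) ⟩
      count (_<ᵇ proj₂ p) (map proj₂ ps)     ≡⟨ rank-in-perm (map proj₂ ps) (subst IsPerm (sym spells-b) b-perm) (∈-map⁺ proj₂ p∈) ⟩
      proj₂ p                                ∎
    where open ≡-Reasoning

≤P-refl : ∀ a → a ≤P a
≤P-refl a = Occurrence⇒≤P a a (Occurrence-refl a)

≤P-trans : ∀ a b c → a ≤P b → b ≤P c → a ≤P c
≤P-trans a b c a≤b b≤c = Occurrence⇒≤P a c (Occurrence-trans (≤P⇒Occurrence a b a≤b) (≤P⇒Occurrence b c b≤c))

≤P-length : ∀ a b → a ≤P b → length a ≤ length b
≤P-length a b a≤b = Occurrence-length (≤P⇒Occurrence a b a≤b)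

≤P-antisym : ∀ a b → IsPerm a → IsPerm b → a ≤P b → b ≤P a → a ≡ b
≤P-antisym a b a-perm b-perm a≤b b≤a =
  Occurrence-equal (≤P⇒Occurrence a b a≤b) a-perm b-perm (≤-antisym (≤P-length a b a≤b) (≤P-length b a b≤a))

≤P-strict : ∀ a b → IsPerm a → IsPerm b → a ≤P b → a ≢ b → length a < length b
≤P-strict a b a-perm b-perm a≤b a≢b =
  ≤∧≢⇒< (≤P-length a b a≤b) (λ same-length → a≢b (Occurrence-equal (≤P⇒Occurrence a b a≤b) a-perm b-perm same-length))

nonempty-above : ∀ σ τ → σ ≤P τ → σ ≢ τ → 0 < length τ
nonempty-above σ (_ ∷ _) _ _ = s≤s z≤n
nonempty-above [] [] _ []≢[] = contradiction refl []≢[]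
nonempty-above (x ∷ σ) [] σ≤[] _ with ≤P-length (x ∷ σ) [] σ≤[]
... | ()

upTo-suc↭ : ∀ k → upTo (suc k) ↭ k ∷ upTo k
upTo-suc↭ k = subst (_↭ k ∷ upTo k) (upTo-∷ʳ k) (↭-sym (∷↭∷ʳ k (upTo k)))

insertions-↭ : ∀ k l {l′} → l′ ∈ insertions k l → l′ ↭ k ∷ l
insertions-↭ k [] (here refl) = ↭.refl
insertions-↭ k (y ∷ ys) (here refl) = ↭.refl
insertions-↭ k (y ∷ ys) (there l′∈) with ∈-map⁻ (y ∷_) l′∈
... | l″ , l″∈ , refl = ↭-trans (↭.prep y (insertions-↭ k ys l″∈)) (↭.swap y k ↭.refl)

perms-↭ : ∀ k {l} → l ∈ perms k → l ↭ upTo k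
perms-↭ zero (here refl) = ↭.refl
perms-↭ (suc k) l∈ with ∈-concat⁻′ (map (insertions k) (perms k)) l∈
... | ls , l∈ls , ls∈ with ∈-map⁻ (insertions k) ls∈
...   | l₀ , l₀∈ , refl =
  ↭-trans (insertions-↭ k l₀ l∈ls) (↭-trans (↭.prep k (perms-↭ k l₀∈)) (↭-sym (upTo-suc↭ k)))

↭upTo⇒length : ∀ {l k} → l ↭ upTo k → length l ≡ k
↭upTo⇒length {k = k} l↭ = trans (↭-length l↭) (length-upTo k)

↭upTo⇒IsPerm : ∀ {l k} → l ↭ upTo k → IsPerm l
↭upTo⇒IsPerm {l} l↭ = subst (λ k → l ↭ upTo k) (sym (↭upTo⇒length l↭)) l↭

-- Every permutation of length k occurs exactly once in `perms k`.  Writing it as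
-- u ++ k-1 ∷ v (the largest entry located), it can only arise by inserting k-1 into u ++ v.

NotIn : ℕ → List ℕ → Set
NotIn k l = ∀ {z} → z ∈ l → z ≢ k

split-at : ∀ k (x : List ℕ) → k ∈ x → ∃ λ u → ∃ λ v → x ≡ u ++ k ∷ v × NotIn k u
split-at k (y ∷ x) k∈ with y ≟ k
... | yes refl = [] , x , refl , (λ ())
... | no y≢k with k∈
...   | here refl = ⊥-elim (y≢k refl)
...   | there k∈′ with split-at k x k∈′
...     | u , v , refl , k∉u = y ∷ u , v , refl , λ { (here refl) → y≢k ; (there z∈) → k∉u z∈ }

indicator : Bool → ℕ
indicator b = if b then 1 else 0

≡ᵇ-refl : ∀ k → (k ≡ᵇ k) ≡ true
≡ᵇ-refl k = T⇒≡true (≡⇒≡ᵇ k k refl)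

≢⇒≡ᵇ-false : ∀ a b → a ≢ b → (a ≡ᵇ b) ≡ false
≢⇒≡ᵇ-false a b a≢b with a ≡ᵇ b in e
... | true = ⊥-elim (a≢b (≡ᵇ⇒≡ a b (T⇐≡true e)))
... | false = refl

count-guarded : {A : Set} (b : Bool) (p : A → Bool) (xs : List A) →
  count (λ x → b ∧ p x) xs ≡ (if b then count p xs else 0)
count-guarded true p xs = refl
count-guarded false p [] = refl
count-guarded false p (x ∷ xs) = count-guarded false p xs

count-prepended : ∀ y a w xs →
  count (_==L (a ∷ w)) (map (y ∷_) xs) ≡ (if y ≡ᵇ a then count (_==L w) xs else 0)
count-prepended y a w xs = trans (count-map _ (y ∷_) xs) (count-guarded (y ≡ᵇ a) (_==L w) xs)

count-insertions : ∀ k l u v → NotIn k l → NotIn k u →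
  count (_==L (u ++ k ∷ v)) (insertions k l) ≡ indicator (l ==L (u ++ v))
count-insertions k [] [] v _ _ rewrite ≡ᵇ-refl k = refl
count-insertions k [] (a ∷ u) v _ k∉u rewrite ≢⇒≡ᵇ-false k a (λ k≡a → k∉u (here refl) (sym k≡a)) = refl
count-insertions k (y ∷ ys) [] v k∉l _
  rewrite ≡ᵇ-refl k | count-prepended y k v (insertions k ys) | ≢⇒≡ᵇ-false y k (k∉l (here refl)) = refl
count-insertions k (y ∷ ys) (a ∷ u) v k∉l k∉u
  rewrite ≢⇒≡ᵇ-false k a (λ k≡a → k∉u (here refl) (sym k≡a))
        | count-prepended y a (u ++ k ∷ v) (insertions k ys)
  with y ≡ᵇ a
... | true = count-insertions k ys u v (λ z∈ → k∉l (there z∈)) (λ z∈ → k∉u (there z∈))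
... | false = refl

count-concat-insertions : ∀ k u v (L : List (List ℕ)) → (∀ {l} → l ∈ L → NotIn k l) → NotIn k u →
  count (_==L (u ++ k ∷ v)) (concatMap (insertions k) L) ≡ count (_==L (u ++ v)) L
count-concat-insertions k u v [] _ _ = refl
count-concat-insertions k u v (l ∷ L) k∉L k∉u = begin
    count (_==L (u ++ k ∷ v)) (insertions k l ++ concatMap (insertions k) L)
  ≡⟨ count-++ _ (insertions k l) (concatMap (insertions k) L) ⟩
    count (_==L (u ++ k ∷ v)) (insertions k l) +ℕ count (_==L (u ++ k ∷ v)) (concatMap (insertions k) L)
  ≡⟨ cong₂ _+ℕ_ (count-insertions k l u v (k∉L (here refl)) k∉u)
               (count-concat-insertions k u v L (λ l∈ → k∉L (there l∈)) k∉u) ⟩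
    indicator (l ==L (u ++ v)) +ℕ count (_==L (u ++ v)) L
  ≡⟨ indicator-+ (l ==L (u ++ v)) _ ⟩
    count (_==L (u ++ v)) (l ∷ L) ∎
  where
  open ≡-Reasoning
  indicator-+ : ∀ b c → indicator b +ℕ c ≡ (if b then suc c else c)
  indicator-+ true c = refl
  indicator-+ false c = refl

perms-count : ∀ k x → x ↭ upTo k → count (_==L x) (perms k) ≡ 1
perms-count zero x x↭ rewrite ↭-empty-inv x↭ = refl
perms-count (suc k) x x↭ with split-at k x (∈-resp-↭ (↭-sym x↭) (∈-upTo⁺ (n<1+n k)))
... | u , v , refl , k∉u =
  trans (count-concat-insertions k u v (perms k) (λ l∈ → max∉ (perms-↭ k l∈)) k∉u) (perms-count k (u ++ v) rest↭)
  where
  max∉ : ∀ {l} → l ↭ upTo k → NotIn k l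
  max∉ l↭ z∈ refl = <-irrefl refl (∈-upTo⁻ (∈-resp-↭ l↭ z∈))
  rest↭ : u ++ v ↭ upTo k
  rest↭ = drop-∷ (↭-trans (↭-sym (shift k u v)) (↭-trans x↭ (upTo-suc↭ k)))

permsUpTo-suc : ∀ n → permsUpTo (suc n) ≡ permsUpTo n ++ perms (suc n)
permsUpTo-suc n = trans (cong (concatMap perms) (sym (upTo-∷ʳ (suc n))))
  (trans (concatMap-++ perms (upTo (suc n)) [ suc n ]) (cong (permsUpTo n ++_) (++-identityʳ (perms (suc n)))))

permsUpTo-member : ∀ n {τ} → τ ∈ permsUpTo n → IsPerm τ × length τ ≤ n
permsUpTo-member zero (here refl) = ↭.refl , z≤n
permsUpTo-member (suc n) {τ} τ∈ with ∈-++⁻ (permsUpTo n) (subst (τ ∈_) (permsUpTo-suc n) τ∈)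
... | inj₁ τ∈′ = proj₁ (permsUpTo-member n τ∈′) , m≤n⇒m≤1+n (proj₂ (permsUpTo-member n τ∈′))
... | inj₂ τ∈′ = ↭upTo⇒IsPerm (perms-↭ (suc n) τ∈′) , ≤-reflexive (↭upTo⇒length (perms-↭ (suc n) τ∈′))

-- x lies either among the shorter permutations (if |x| ≤ n) or among those of length n+1.
permsUpTo-count : ∀ n x → IsPerm x → length x ≤ n → count (_==L x) (permsUpTo n) ≡ 1
permsUpTo-count zero [] _ _ = refl
permsUpTo-count (suc n) x x-perm x≤ = begin
    count (_==L x) (permsUpTo (suc n))
  ≡⟨ cong (count (_==L x)) (permsUpTo-suc n) ⟩
    count (_==L x) (permsUpTo n ++ perms (suc n))
  ≡⟨ count-++ (_==L x) (permsUpTo n) (perms (suc n)) ⟩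
    count (_==L x) (permsUpTo n) +ℕ count (_==L x) (perms (suc n))
  ≡⟨ by-length (length x ≤? n) ⟩
    1 ∎
  where
  open ≡-Reasoning
  by-length : Dec (length x ≤ n) → count (_==L x) (permsUpTo n) +ℕ count (_==L x) (perms (suc n)) ≡ 1
  by-length (yes x≤n) = cong₂ _+ℕ_ (permsUpTo-count n x x-perm x≤n) (count-absent _ (perms (suc n)) too-long)
    where
    too-long : ∀ {τ} → τ ∈ perms (suc n) → (τ ==L x) ≡ false
    too-long {τ} τ∈ = ≢⇒==L-false τ x λ { refl →
      <-irrefl refl (≤-trans (s≤s x≤n) (≤-reflexive (sym (↭upTo⇒length (perms-↭ (suc n) τ∈))))) }
  by-length (no x≰n) = cong₂ _+ℕ_ (count-absent _ (permsUpTo n) too-short)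
                                   (perms-count (suc n) x (subst (λ k → x ↭ upTo k) x-length x-perm))
    where
    x-length : length x ≡ suc n
    x-length = ≤-antisym x≤ (≰⇒> x≰n)
    too-short : ∀ {τ} → τ ∈ permsUpTo n → (τ ==L x) ≡ false
    too-short {τ} τ∈ = ≢⇒==L-false τ x λ { refl → x≰n (proj₂ (permsUpTo-member n τ∈)) }

between : Perm → Perm → Perm → Bool
between a b τ = contains a τ ∧ contains τ b

-- Computing [a,b] inside a longer enumeration adds nothing: longer permutations are not below b.
closedInterval-bound : ∀ a b m → length b ≤ m → filterᵇ (between a b) (permsUpTo m) ≡ closedInterval a b
closedInterval-bound a b m b≤m = subst (λ k → filterᵇ (between a b) (permsUpTo k) ≡ closedInterval a b)
  (m∸n+n≡m b≤m) (extend (m ∸ length b))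
  where
  extend : ∀ d → filterᵇ (between a b) (permsUpTo (d +ℕ length b)) ≡ closedInterval a b
  extend zero = refl
  extend (suc d) = begin
      filterᵇ (between a b) (permsUpTo (suc (d +ℕ length b)))
    ≡⟨ cong (filterᵇ (between a b)) (permsUpTo-suc (d +ℕ length b)) ⟩
      filterᵇ (between a b) (permsUpTo (d +ℕ length b) ++ perms (suc (d +ℕ length b)))
    ≡⟨ filter-++ (T? ∘ between a b) (permsUpTo (d +ℕ length b)) (perms (suc (d +ℕ length b))) ⟩
      filterᵇ (between a b) (permsUpTo (d +ℕ length b)) ++ filterᵇ (between a b) (perms (suc (d +ℕ length b)))
    ≡⟨ cong₂ _++_ (extend d) (filter-none (T? ∘ between a b) (All.tabulate too-long)) ⟩
      closedInterval a b ++ []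
    ≡⟨ ++-identityʳ _ ⟩
      closedInterval a b ∎
    where
    open ≡-Reasoning
    too-long : ∀ {τ} → τ ∈ perms (suc (d +ℕ length b)) → ¬ T (between a b τ)
    too-long {τ} τ∈ τ∈[a,b] = <⇒≱ (s≤s (m≤n+m (length b) d))
      (subst (_≤ length b) (↭upTo⇒length (perms-↭ _ τ∈)) (≤P-length τ b (proj₂ (Equivalence.to T-∧ τ∈[a,b]))))

∈closedInterval : ∀ a b {τ} → τ ∈ closedInterval a b → IsPerm τ × a ≤P τ × τ ≤P b
∈closedInterval a b τ∈ with ∈-filter⁻ (T? ∘ between a b) {xs = permsUpTo (length b)} τ∈
... | τ∈P , inside = proj₁ (permsUpTo-member (length b) τ∈P) , Equivalence.to T-∧ inside

∈halfOpenInterval : ∀ a b {τ} → τ ∈ halfOpenInterval a b → τ ∈ closedInterval a b × τ ≢ b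
∈halfOpenInterval a b τ∈ with ∈-filter⁻ (T? ∘ (λ τ → not (τ ==L b))) {xs = closedInterval a b} τ∈
... | τ∈[a,b] , τ≠b = τ∈[a,b] , λ { refl → subst (T ∘ not) (==L-refl b) τ≠b }

count-filterᵇ : ∀ (p : Perm → Bool) x xs → p x ≡ true → count (_==L x) (filterᵇ p xs) ≡ count (_==L x) xs
count-filterᵇ p x [] _ = refl
count-filterᵇ p x (y ∷ xs) px with p y in py
... | true = cong (λ c → if y ==L x then suc c else c) (count-filterᵇ p x xs px)
... | false with y ==L x in y=x
...   | false = count-filterᵇ p x xs px
...   | true with ==L⇒≡ y x (T⇐≡true y=x)
...     | refl = contradiction (trans (sym px) py) λ ()

closedInterval-count : ∀ a b x → IsPerm x → a ≤P x → x ≤P b → count (_==L x) (closedInterval a b) ≡ 1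
closedInterval-count a b x x-perm a≤x x≤b =
  trans (count-filterᵇ (between a b) x (permsUpTo (length b)) (T⇒≡true (Equivalence.from T-∧ (a≤x , x≤b))))
        (permsUpTo-count (length b) x x-perm (≤P-length x b x≤b))

∈halfOpenInterval⇒shorter : ∀ a b {τ} → IsPerm b → τ ∈ halfOpenInterval a b → IsPerm τ × length τ < length b
∈halfOpenInterval⇒shorter a b b-perm τ∈ with ∈halfOpenInterval a b τ∈
... | τ∈[a,b] , τ≢b with ∈closedInterval a b τ∈[a,b]
...   | τ-perm , _ , τ≤b = τ-perm , ≤P-strict _ b τ-perm b-perm τ≤b τ≢b

module MöbiusSums {c ℓ} (R : CommutativeRing c ℓ) where

  open CommutativeRing R renaming (refl to ≈-refl; sym to ≈-sym; trans to ≈-trans)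
  open import Algebra.Properties.Ring ring using (-‿distribʳ-*; -‿involutive; -‿+-comm; -0#≈0#)
  open import Relation.Binary.Reasoning.Setoid setoid

  ∑ : {A : Set} → List A → (A → Carrier) → Carrier
  ∑ = Σ R

  infix 5 _when_
  _when_ : Carrier → Bool → Carrier
  x when b = if b then x else 0#

  when-true : ∀ {b} x → b ≡ true → x when b ≈ x
  when-true x refl = ≈-refl

  when-false : ∀ {b} x → b ≡ false → x when b ≈ 0#
  when-false x refl = ≈-refl

  when-cong : ∀ b {x y} → x ≈ y → x when b ≈ y when b
  when-cong true x≈y = x≈y
  when-cong false x≈y = ≈-refl

  when-∧ : ∀ a b x → (x when a) when b ≈ x when (a ∧ b)
  when-∧ true true x = ≈-refl
  when-∧ false true x = ≈-refl
  when-∧ true false x = ≈-refl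
  when-∧ false false x = ≈-refl

  when-⇔ : ∀ a b x → (T a → T b) → (T b → T a) → x when a ≈ x when b
  when-⇔ true true x _ _ = ≈-refl
  when-⇔ false false x _ _ = ≈-refl
  when-⇔ true false x a⇒b _ = ⊥-elim (a⇒b _)
  when-⇔ false true x _ b⇒a = ⊥-elim (b⇒a _)

  *-when : ∀ b x y → x * (y when b) ≈ (x * y) when b
  *-when true x y = ≈-refl
  *-when false x y = zeroʳ x

  when-split : ∀ b x → x ≈ (x when not b) + (x when b)
  when-split true x = ≈-sym (+-identityˡ x)
  when-split false x = ≈-sym (+-identityʳ x)

  subtract-difference : ∀ a b → a + - (a + - b) ≈ b
  subtract-difference a b = begin
      a + - (a + - b)     ≈⟨ +-congˡ (≈-sym (-‿+-comm a (- b))) ⟩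
      a + (- a + - - b)   ≈⟨ +-congˡ (+-congˡ (-‿involutive b)) ⟩
      a + (- a + b)       ≈⟨ ≈-sym (+-assoc a (- a) b) ⟩
      (a + - a) + b       ≈⟨ +-congʳ (-‿inverseʳ a) ⟩
      0# + b              ≈⟨ +-identityˡ b ⟩
      b                   ∎

  solve-for : ∀ a b c → a + b ≈ c → a ≈ c + - b
  solve-for a b c a+b≈c = begin
      a                ≈⟨ ≈-sym (+-identityʳ a) ⟩
      a + 0#           ≈⟨ +-congˡ (≈-sym (-‿inverseʳ b)) ⟩
      a + (b + - b)    ≈⟨ ≈-sym (+-assoc a b (- b)) ⟩
      (a + b) + - b    ≈⟨ +-congʳ a+b≈c ⟩
      c + - b          ∎

  ∑-cong : {A : Set} (xs : List A) {f g : A → Carrier} → (∀ {x} → x ∈ xs → f x ≈ g x) → ∑ xs f ≈ ∑ xs g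
  ∑-cong [] _ = ≈-refl
  ∑-cong (x ∷ xs) f≈g = +-cong (f≈g (here refl)) (∑-cong xs (f≈g ∘ there))

  ∑-zero : {A : Set} (xs : List A) {f : A → Carrier} → (∀ {x} → x ∈ xs → f x ≈ 0#) → ∑ xs f ≈ 0#
  ∑-zero [] _ = ≈-refl
  ∑-zero (x ∷ xs) f≈0 = ≈-trans (+-cong (f≈0 (here refl)) (∑-zero xs (f≈0 ∘ there))) (+-identityˡ 0#)

  ∑-+ : {A : Set} (xs : List A) (f g : A → Carrier) → ∑ xs (λ x → f x + g x) ≈ ∑ xs f + ∑ xs g
  ∑-+ [] f g = ≈-sym (+-identityˡ 0#)
  ∑-+ (x ∷ xs) f g = begin
      (f x + g x) + ∑ xs (λ y → f y + g y)  ≈⟨ +-congˡ (∑-+ xs f g) ⟩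
      (f x + g x) + (∑ xs f + ∑ xs g)      ≈⟨ +-assoc (f x) (g x) _ ⟩
      f x + (g x + (∑ xs f + ∑ xs g))      ≈⟨ +-congˡ (≈-sym (+-assoc (g x) _ _)) ⟩
      f x + ((g x + ∑ xs f) + ∑ xs g)      ≈⟨ +-congˡ (+-congʳ (+-comm (g x) _)) ⟩
      f x + ((∑ xs f + g x) + ∑ xs g)      ≈⟨ +-congˡ (+-assoc _ (g x) _) ⟩
      f x + (∑ xs f + (g x + ∑ xs g))      ≈⟨ ≈-sym (+-assoc (f x) _ _) ⟩
      (f x + ∑ xs f) + (g x + ∑ xs g)      ∎

  ∑-neg : {A : Set} (xs : List A) (f : A → Carrier) → ∑ xs (λ x → - f x) ≈ - ∑ xs f
  ∑-neg [] f = ≈-sym -0#≈0#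
  ∑-neg (x ∷ xs) f = ≈-trans (+-congˡ (∑-neg xs f)) (-‿+-comm (f x) (∑ xs f))

  ∑-*ˡ : {A : Set} (a : Carrier) (xs : List A) (f : A → Carrier) → a * ∑ xs f ≈ ∑ xs (λ x → a * f x)
  ∑-*ˡ a [] f = zeroʳ a
  ∑-*ˡ a (x ∷ xs) f = ≈-trans (distribˡ a (f x) _) (+-congˡ (∑-*ˡ a xs f))

  ∑-when : {A : Set} (b : Bool) (xs : List A) (f : A → Carrier) → (∑ xs f) when b ≈ ∑ xs (λ x → f x when b)
  ∑-when true xs f = ≈-refl
  ∑-when false xs f = ≈-sym (∑-zero xs (λ _ → ≈-refl))

  ∑-swap : {A B : Set} (xs : List A) (ys : List B) (h : A → B → Carrier) →
    ∑ xs (λ x → ∑ ys (h x)) ≈ ∑ ys (λ y → ∑ xs (λ x → h x y))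
  ∑-swap [] ys h = ≈-sym (∑-zero ys (λ _ → ≈-refl))
  ∑-swap (x ∷ xs) ys h = ≈-trans (+-congˡ (∑-swap xs ys h)) (≈-sym (∑-+ ys (h x) (λ y → ∑ xs (λ x′ → h x′ y))))

  ∑-filterᵇ : {A : Set} (p : A → Bool) (xs : List A) (f : A → Carrier) →
    ∑ (filterᵇ p xs) f ≈ ∑ xs (λ x → f x when p x)
  ∑-filterᵇ p [] f = ≈-refl
  ∑-filterᵇ p (x ∷ xs) f with p x
  ... | true = +-congˡ (∑-filterᵇ p xs f)
  ... | false = ≈-trans (∑-filterᵇ p xs f) (≈-sym (+-identityˡ _))

  ∑-pick : (xs : List Perm) (x : Perm) (f : Perm → Carrier) →
    count (_==L x) xs ≡ 1 → ∑ xs (λ τ → f τ when τ ==L x) ≈ f x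
  ∑-pick (y ∷ xs) x f once with y ==L x in y=x
  ... | false = ≈-trans (+-identityˡ _) (∑-pick xs x f once)
  ... | true with ==L⇒≡ y x (T⇐≡true y=x)
  ...   | refl = ≈-trans (+-congˡ (∑-zero xs absent)) (+-identityʳ (f x))
    where
    absent : ∀ {τ} → τ ∈ xs → f τ when τ ==L x ≈ 0#
    absent τ∈ = when-false _ (count≡0⇒rejects (_==L x) xs (suc-injective once) τ∈)

  closedInterval-split : ∀ a b (g : Perm → Carrier) → IsPerm b → a ≤P b →
    ∑ (closedInterval a b) g ≈ ∑ (halfOpenInterval a b) g + g b
  closedInterval-split a b g b-perm a≤b = begin
      ∑ [a,b] g
    ≈⟨ ∑-cong [a,b] (λ {l} _ → when-split (l ==L b) (g l)) ⟩
      ∑ [a,b] (λ l → (g l when not (l ==L b)) + (g l when l ==L b))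
    ≈⟨ ∑-+ [a,b] _ _ ⟩
      ∑ [a,b] (λ l → g l when not (l ==L b)) + ∑ [a,b] (λ l → g l when l ==L b)
    ≈⟨ +-cong (≈-sym (∑-filterᵇ (λ l → not (l ==L b)) [a,b] g))
              (∑-pick [a,b] b g (closedInterval-count a b b b-perm a≤b (≤P-refl b))) ⟩
      ∑ (halfOpenInterval a b) g + g b ∎
    where
    [a,b] : List Perm
    [a,b] = closedInterval a b

  halfOpenInterval-empty : ∀ a (g : Perm → Carrier) → IsPerm a → ∑ (halfOpenInterval a a) g ≈ 0#
  halfOpenInterval-empty a g a-perm = ∑-zero (halfOpenInterval a a) λ τ∈ → ⊥-elim (a≢τ τ∈)
    where
    a≢τ : ∀ {τ} → τ ∈ halfOpenInterval a a → ⊥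
    a≢τ τ∈ with ∈halfOpenInterval a a τ∈
    ... | τ∈[a,a] , τ≢a with ∈closedInterval a a τ∈[a,a]
    ...   | τ-perm , a≤τ , τ≤a = τ≢a (≤P-antisym _ a τ-perm a-perm τ≤a a≤τ)

  μ-refl : ∀ σ → μ R σ σ ≈ 1#
  μ-refl σ rewrite T⇒≡true (≤P-refl σ) | ==L-refl σ = ≈-refl

  μ-fuel-stable : ∀ m n σ τ → IsPerm τ → length τ ≤ m → length τ ≤ n → μ-fuel R m σ τ ≈ μ-fuel R n σ τ
  μ-fuel-stable m n σ τ τ-perm τ≤m τ≤n with contains σ τ in σ≤τ | σ ==L τ in σ=τ
  ... | false | _ = ≈-refl
  ... | true | true = ≈-refl
  μ-fuel-stable zero n σ τ τ-perm τ≤0 τ≤n | true | false =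
    ⊥-elim (<⇒≱ (nonempty-above σ τ (T⇐≡true σ≤τ) (==L-false⇒≢ σ τ σ=τ)) τ≤0)
  μ-fuel-stable (suc m) zero σ τ τ-perm τ≤m τ≤0 | true | false =
    ⊥-elim (<⇒≱ (nonempty-above σ τ (T⇐≡true σ≤τ) (==L-false⇒≢ σ τ σ=τ)) τ≤0)
  μ-fuel-stable (suc m) (suc n) σ τ τ-perm τ≤m τ≤n | true | false =
    -‿cong (∑-cong (halfOpenInterval σ τ) λ λ∈ →
      let λ-perm , shorter = ∈halfOpenInterval⇒shorter σ τ τ-perm λ∈ in
      μ-fuel-stable m n σ _ λ-perm (≤-pred (≤-trans shorter τ≤m)) (≤-pred (≤-trans shorter τ≤n)))

  μ-unfold : ∀ σ τ → IsPerm τ → σ ≤P τ → σ ≢ τ → μ R σ τ ≈ - ∑ (halfOpenInterval σ τ) (μ R σ)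
  μ-unfold σ τ τ-perm σ≤τ σ≢τ = unfold (length τ) refl
    where
    unfold : ∀ n → n ≡ length τ → μ-fuel R n σ τ ≈ - ∑ (halfOpenInterval σ τ) (μ R σ)
    unfold zero 0≡τ = ⊥-elim (<⇒≱ (nonempty-above σ τ σ≤τ σ≢τ) (≤-reflexive (sym 0≡τ)))
    unfold (suc n) n≡τ rewrite T⇒≡true σ≤τ | ≢⇒==L-false σ τ σ≢τ =
      -‿cong (∑-cong (halfOpenInterval σ τ) λ λ∈ →
        let λ-perm , shorter = ∈halfOpenInterval⇒shorter σ τ τ-perm λ∈ in
        μ-fuel-stable n _ σ _ λ-perm (≤-pred (≤-trans shorter (≤-reflexive (sym n≡τ)))) ≤-refl)

  μ-sum : ∀ σ τ → IsPerm τ → σ ≤P τ → ∑ (closedInterval σ τ) (μ R σ) ≈ 1# when τ ==L σ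
  μ-sum σ τ τ-perm σ≤τ with τ ==L σ in τ=σ
  ... | true with ==L⇒≡ τ σ (T⇐≡true τ=σ)
  ...   | refl = begin
      ∑ (closedInterval σ σ) (μ R σ)               ≈⟨ closedInterval-split σ σ (μ R σ) τ-perm σ≤τ ⟩
      ∑ (halfOpenInterval σ σ) (μ R σ) + μ R σ σ   ≈⟨ +-cong (halfOpenInterval-empty σ (μ R σ) τ-perm) (μ-refl σ) ⟩
      0# + 1#                                       ≈⟨ +-identityˡ 1# ⟩
      1#                                            ∎
  μ-sum σ τ τ-perm σ≤τ | false = begin
      ∑ (closedInterval σ τ) (μ R σ)                                     ≈⟨ closedInterval-split σ τ (μ R σ) τ-perm σ≤τ ⟩
      ∑ (halfOpenInterval σ τ) (μ R σ) + μ R σ τ                         ≈⟨ +-congˡ (μ-unfold σ τ τ-perm σ≤τ σ≢τ) ⟩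
      ∑ (halfOpenInterval σ τ) (μ R σ) + - ∑ (halfOpenInterval σ τ) (μ R σ) ≈⟨ -‿inverseʳ _ ⟩
      0#                                                                 ∎
    where
    σ≢τ : σ ≢ τ
    σ≢τ = ≢-sym (==L-false⇒≢ τ σ τ=σ)

  when³-⇔ : ∀ a₁ a₂ a₃ b₁ b₂ b₃ x →
    (T a₁ → T a₂ → T a₃ → T b₁ × T b₂ × T b₃) → (T b₁ → T b₂ → T b₃ → T a₁ × T a₂ × T a₃) →
    ((x when a₁) when a₂) when a₃ ≈ ((x when b₁) when b₂) when b₃
  when³-⇔ a₁ a₂ a₃ b₁ b₂ b₃ x a⇒b b⇒a = begin
      ((x when a₁) when a₂) when a₃  ≈⟨ flatten a₁ a₂ a₃ ⟩
      x when ((a₁ ∧ a₂) ∧ a₃)        ≈⟨ when-⇔ _ _ x (convert a⇒b) (convert b⇒a) ⟩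
      x when ((b₁ ∧ b₂) ∧ b₃)        ≈⟨ ≈-sym (flatten b₁ b₂ b₃) ⟩
      ((x when b₁) when b₂) when b₃  ∎
    where
    flatten : ∀ c₁ c₂ c₃ → ((x when c₁) when c₂) when c₃ ≈ x when ((c₁ ∧ c₂) ∧ c₃)
    flatten c₁ c₂ c₃ = ≈-trans (when-cong c₃ (when-∧ c₁ c₂ x)) (when-∧ (c₁ ∧ c₂) c₃ x)
    convert : ∀ {c₁ c₂ c₃ d₁ d₂ d₃} → (T c₁ → T c₂ → T c₃ → T d₁ × T d₂ × T d₃) →
      T ((c₁ ∧ c₂) ∧ c₃) → T ((d₁ ∧ d₂) ∧ d₃)
    convert c⇒d c = let c₁₂ , c₃ = Equivalence.to T-∧ c ; c₁ , c₂ = Equivalence.to T-∧ c₁₂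
                        d₁ , d₂ , d₃ = c⇒d c₁ c₂ c₃
                    in Equivalence.from T-∧ (Equivalence.from T-∧ (d₁ , d₂) , d₃)

  -- The region σ ≤ λ ≤ τ ≤ π with λ ≠ π, described with λ outermost or with τ outermost.
  region-swap : ∀ σ π l t x →
    ((x when between l π t) when not (l ==L π)) when between σ π l ≈
    ((x when not (l ==L π)) when between σ t l) when between σ π t
  region-swap σ π l t x = when³-⇔ _ _ _ _ _ _ x
    (λ l≤t≤π l≠π σ≤l≤π → let l≤t , t≤π = Equivalence.to T-∧ l≤t≤π ; σ≤l , _ = Equivalence.to T-∧ σ≤l≤π in
      l≠π , Equivalence.from T-∧ (σ≤l , l≤t) , Equivalence.from T-∧ (≤P-trans σ l t σ≤l l≤t , t≤π))
    (λ l≠π σ≤l≤t σ≤t≤π → let σ≤l , l≤t = Equivalence.to T-∧ σ≤l≤t ; _ , t≤π = Equivalence.to T-∧ σ≤t≤π in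
      Equivalence.from T-∧ (l≤t , t≤π) , l≠π , Equivalence.from T-∧ (σ≤l , ≤P-trans l t π l≤t t≤π))

  interval-swap : ∀ σ π (g : Perm → Perm → Carrier) →
    ∑ (halfOpenInterval σ π) (λ l → ∑ (closedInterval l π) (g l)) ≈
    ∑ (closedInterval σ π) (λ t → ∑ (closedInterval σ t) (λ l → g l t when not (l ==L π)))
  interval-swap σ π g = begin
      ∑ (halfOpenInterval σ π) (λ l → ∑ (closedInterval l π) (g l))
    ≈⟨ ∑-filterᵇ (λ l → not (l ==L π)) (closedInterval σ π) _ ⟩
      ∑ (closedInterval σ π) (λ l → ∑ (closedInterval l π) (g l) when not (l ==L π))
    ≈⟨ ∑-filterᵇ (between σ π) P _ ⟩
      ∑ P (λ l → (∑ (closedInterval l π) (g l) when not (l ==L π)) when between σ π l)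
    ≈⟨ ∑-cong P (λ {l} _ → expand-outer l) ⟩
      ∑ P (λ l → ∑ P (λ t → ((g l t when between l π t) when not (l ==L π)) when between σ π l))
    ≈⟨ ∑-swap P P _ ⟩
      ∑ P (λ t → ∑ P (λ l → ((g l t when between l π t) when not (l ==L π)) when between σ π l))
    ≈⟨ ∑-cong P (λ {t} _ → ∑-cong P (λ {l} _ → region-swap σ π l t (g l t))) ⟩
      ∑ P (λ t → ∑ P (λ l → ((g l t when not (l ==L π)) when between σ t l) when between σ π t))
    ≈⟨ ∑-cong P (λ {t} t∈P → ≈-sym (expand-inner t t∈P)) ⟩
      ∑ P (λ t → ∑ (closedInterval σ t) (λ l → g l t when not (l ==L π)) when between σ π t)
    ≈⟨ ≈-sym (∑-filterᵇ (between σ π) P _) ⟩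
      ∑ (closedInterval σ π) (λ t → ∑ (closedInterval σ t) (λ l → g l t when not (l ==L π))) ∎
    where
    P : List Perm
    P = permsUpTo (length π)
    expand-outer : ∀ l → (∑ (closedInterval l π) (g l) when not (l ==L π)) when between σ π l ≈
                          ∑ P (λ t → ((g l t when between l π t) when not (l ==L π)) when between σ π l)
    expand-outer l = ≈-trans (when-cong (between σ π l)
        (≈-trans (when-cong (not (l ==L π)) (∑-filterᵇ (between l π) P (g l))) (∑-when _ P _)))
      (∑-when _ P _)
    expand-inner : ∀ t → t ∈ P → ∑ (closedInterval σ t) (λ l → g l t when not (l ==L π)) when between σ π t ≈
                          ∑ P (λ l → ((g l t when not (l ==L π)) when between σ t l) when between σ π t)
    expand-inner t t∈P = ≈-trans (when-cong (between σ π t) (begin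
        ∑ (closedInterval σ t) (λ l → g l t when not (l ==L π))
      ≡⟨ cong (λ C → ∑ C (λ l → g l t when not (l ==L π)))
                (sym (closedInterval-bound σ t (length π) (proj₂ (permsUpTo-member (length π) t∈P)))) ⟩
        ∑ (filterᵇ (between σ t) P) (λ l → g l t when not (l ==L π))
      ≈⟨ ∑-filterᵇ (between σ t) P _ ⟩
        ∑ P (λ l → (g l t when not (l ==L π)) when between σ t l) ∎))
      (∑-when _ P _)

  truncated-μ-sum : ∀ σ π τ → IsPerm π → τ ∈ closedInterval σ π →
    ∑ (closedInterval σ τ) (λ l → μ R σ l when not (l ==L π)) ≈ (1# when τ ==L σ) + - (μ R σ π when τ ==L π)
  truncated-μ-sum σ π τ π-perm τ∈ with ∈closedInterval σ π τ∈ | τ ==L π in τ=π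
  ... | τ-perm , σ≤τ , τ≤π | false = begin
      ∑ (closedInterval σ τ) (λ l → μ R σ l when not (l ==L π))  ≈⟨ ∑-cong (closedInterval σ τ) (λ l∈ → when-true _ (below-top l∈)) ⟩
      ∑ (closedInterval σ τ) (μ R σ)                             ≈⟨ μ-sum σ τ τ-perm σ≤τ ⟩
      1# when τ ==L σ                                            ≈⟨ ≈-sym (+-identityʳ _) ⟩
      (1# when τ ==L σ) + 0#                                     ≈⟨ +-congˡ (≈-sym -0#≈0#) ⟩
      (1# when τ ==L σ) + - 0#                                   ∎
    where
    τ<π : length τ < length π
    τ<π = ≤P-strict τ π τ-perm π-perm τ≤π (==L-false⇒≢ τ π τ=π)
    below-top : ∀ {l} → l ∈ closedInterval σ τ → not (l ==L π) ≡ true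
    below-top {l} l∈ with ∈closedInterval σ τ l∈ | l ==L π in l=π
    ... | _ | false = refl
    ... | _ , _ , l≤τ | true with ==L⇒≡ l π (T⇐≡true l=π)
    ...   | refl = ⊥-elim (<⇒≱ τ<π (≤P-length π τ l≤τ))
  ... | τ-perm , σ≤τ , τ≤π | true with ==L⇒≡ τ π (T⇐≡true τ=π)
  ...   | refl = begin
      ∑ (closedInterval σ π) (λ l → μ R σ l when not (l ==L π))  ≈⟨ ≈-sym (∑-filterᵇ _ (closedInterval σ π) (μ R σ)) ⟩
      ∑ (halfOpenInterval σ π) (μ R σ)                           ≈⟨ solve-for _ _ _ (≈-trans
                                                                      (≈-sym (closedInterval-split σ π (μ R σ) π-perm σ≤τ))
                                                                      (μ-sum σ π π-perm σ≤τ)) ⟩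
      (1# when π ==L σ) + - μ R σ π                              ∎

  weighted-μ-sum : ∀ σ π → IsPerm σ → IsPerm π → σ ≤P π → (F : Perm → Carrier) →
    ∑ (halfOpenInterval σ π) (λ l → μ R σ l * ∑ (closedInterval l π) F) ≈ F σ + - (F π * μ R σ π)
  weighted-μ-sum σ π σ-perm π-perm σ≤π F = begin
      ∑ (halfOpenInterval σ π) (λ l → μ R σ l * ∑ (closedInterval l π) F)
    ≈⟨ ∑-cong (halfOpenInterval σ π) (λ {l} _ → ∑-*ˡ (μ R σ l) (closedInterval l π) F) ⟩
      ∑ (halfOpenInterval σ π) (λ l → ∑ (closedInterval l π) (λ t → μ R σ l * F t))
    ≈⟨ interval-swap σ π (λ l t → μ R σ l * F t) ⟩
      ∑ [σ,π] (λ t → ∑ (closedInterval σ t) (λ l → μ R σ l * F t when not (l ==L π)))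
    ≈⟨ ∑-cong [σ,π] (λ {t} t∈ → factor-out t t∈) ⟩
      ∑ [σ,π] (λ t → (F t when t ==L σ) + - (F t * μ R σ π when t ==L π))
    ≈⟨ ≈-trans (∑-+ [σ,π] _ _) (+-congˡ (∑-neg [σ,π] _)) ⟩
      ∑ [σ,π] (λ t → F t when t ==L σ) + - ∑ [σ,π] (λ t → F t * μ R σ π when t ==L π)
    ≈⟨ +-cong (∑-pick [σ,π] σ F (closedInterval-count σ π σ σ-perm (≤P-refl σ) σ≤π))
              (-‿cong (∑-pick [σ,π] π (λ t → F t * μ R σ π) (closedInterval-count σ π π π-perm σ≤π (≤P-refl π)))) ⟩
      F σ + - (F π * μ R σ π) ∎
    where
    [σ,π] : List Perm
    [σ,π] = closedInterval σ π
    factor-out : ∀ t → t ∈ [σ,π] →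
      ∑ (closedInterval σ t) (λ l → μ R σ l * F t when not (l ==L π)) ≈ (F t when t ==L σ) + - (F t * μ R σ π when t ==L π)
    factor-out t t∈ = begin
        ∑ (closedInterval σ t) (λ l → μ R σ l * F t when not (l ==L π))
      ≈⟨ ∑-cong (closedInterval σ t) (λ {l} _ → ≈-trans (when-cong (not (l ==L π)) (*-comm _ (F t))) (≈-sym (*-when _ (F t) _))) ⟩
        ∑ (closedInterval σ t) (λ l → F t * (μ R σ l when not (l ==L π)))
      ≈⟨ ≈-sym (∑-*ˡ (F t) (closedInterval σ t) _) ⟩
        F t * ∑ (closedInterval σ t) (λ l → μ R σ l when not (l ==L π))
      ≈⟨ *-congˡ (truncated-μ-sum σ π t π-perm t∈) ⟩
        F t * ((1# when t ==L σ) + - (μ R σ π when t ==L π))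
      ≈⟨ distribˡ (F t) _ _ ⟩
        F t * (1# when t ==L σ) + F t * - (μ R σ π when t ==L π)
      ≈⟨ +-cong (≈-trans (*-when _ (F t) 1#) (when-cong (t ==L σ) (*-identityʳ (F t))))
                (≈-trans (≈-sym (-‿distribʳ-* (F t) _)) (-‿cong (*-when _ (F t) _))) ⟩
        (F t when t ==L σ) + - (F t * μ R σ π when t ==L π) ∎

open MöbiusSums

proposition2p4 : ∀ {c ℓ} (R : CommutativeRing c ℓ) → let open CommutativeRing R in
    (σ π : Perm) → IsPerm σ → IsPerm π → σ ≤P π →
    (F : Perm → Carrier) → F π ≈ 1# →
    μ R σ π ≈ F σ + - Σ R (halfOpenInterval σ π)
                          (λ λ' → μ R σ λ' * Σ R (closedInterval λ' π) F)
proposition2p4 R σ π σ-perm π-perm σ≤π F Fπ≈1 = begin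
    μ R σ π
  ≈⟨ ≈-sym (subtract-difference R (F σ) (μ R σ π)) ⟩
    F σ + - (F σ + - μ R σ π)
  ≈⟨ +-congˡ (-‿cong (+-congˡ (-‿cong (≈-sym weight-at-top)))) ⟩
    F σ + - (F σ + - (F π * μ R σ π))
  ≈⟨ +-congˡ (-‿cong (≈-sym (weighted-μ-sum R σ π σ-perm π-perm σ≤π F))) ⟩
    F σ + - Σ R (halfOpenInterval σ π) (λ λ' → μ R σ λ' * Σ R (closedInterval λ' π) F) ∎
  where
  open CommutativeRing R renaming (sym to ≈-sym; trans to ≈-trans)
  open import Relation.Binary.Reasoning.Setoid setoid
  weight-at-top : F π * μ R σ π ≈ μ R σ π
  weight-at-top = ≈-trans (*-congʳ Fπ≈1) (*-identityˡ (μ R σ π))
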